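{- Let $P$ be a CCS$^!$ expression. For every path $\pi=dec(P)\,u_1\,M_1\,u_2\,M_2\,u_3\dots$ of the unmarked Petri net of CCS$^!$ there is a unique path $\widehat\pi=P\xrightarrow{\alpha_1}P_1\xrightarrow{\alpha_2}P_2\xrightarrow{\alpha_3}\dots$ of the same (finite or infinite) length in the LTS of CCS$^!$ with $dec(P_i)=M_i$ and $\ell(u_i)=\alpha_i$ for all $i$.
   Context: CCS$^!$: names $\mathcal A$, agent identifiers $\mathcal K$, output actions $O$; handshake actions $H=\mathcal A\uplus\{\bar a\mid a\in\mathcal A\}$ with $\bar{\bar a}=a$; $Act=H\uplus O\uplus\{\tau\}$. A relabelling is $f:H\to H$ with $f(\bar a)=\overline{f(a)}$, extended by identity on $O\cup\{\tau\}$. Expressions: agent identifiers $A$ (with defining equations $A\stackrel{def}{=}P$), $\alpha.P$, $\sum_{i\in I}P_i$, $P|Q$, $P\backslash a$, $P[f]$. LTS rules: $\alpha.P\xrightarrow{\alpha}P$; $P_j\xrightarrow{\alpha}P'$, $j\in I$ gives $\sum_{i\in I}P_i\xrightarrow{\alpha}P'$; $P\xrightarrow{\alpha}P'$ gives $P|Q\xrightarrow{\alpha}P'|Q$; $Q\xrightarrow{\alpha}Q'$ gives $P|Q\xrightarrow{\alpha}P|Q'$; $P\xrightarrow{a}P'$, $Q\xrightarrow{\bar a}Q'$ gives $P|Q\xrightarrow{\tau}P'|Q'$; $P\xrightarrow{\alpha}P'$, $a\ne\alpha\ne\bar a$ gives $P\backslash a\xrightarrow{\alpha}P'\backslash a$;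 $P\xrightarrow{\alpha}P'$ gives $P[f]\xrightarrow{f(\alpha)}P'[f]$; $P\xrightarrow{\alpha}P'$, $A\stackrel{def}{=}P$ give $A\xrightarrow{\alpha}P'$. A path in the LTS from $P$ is an alternating sequence of states and transitions starting at $P$, infinite or ending in a state. Unmarked Petri net: places (grapes) form the smallest set containing $A$, $\alpha.P$, $\sum_{i\in I}P_i$, and $\mu\backslash a$, $\mu|$, $|\mu$, $\mu[f]$ for grapes $\mu$. $dec(\alpha.P)=\{\alpha.P\}$, $dec(A)=\{A\}$, $dec(\sum_{i\in I}P_i)=\{\sum_{i\in I}P_i\}$, $dec(P|Q)=dec(P)|\cup|dec(Q)$, $dec(P\backslash a)=dec(P)\backslash a$, $dec(P[f])=dec(P)[f]$ (constructors applied elementwise). Transitions $u$ are triples $H\xrightarrow{\alpha}J$ (preset $H$, postset $J$, label $\ell(u)=\alpha$, multisets of grapes) derived by: $\{\alpha.P\}\xrightarrow{\alpha}dec(P)$; $(dec(P_j)-K)\xrightarrow{\alpha}J$, $j\in I$, $K\le dec(P_j)$ gives $\{\sum_{i\in I}P_i\}\xrightarrow{\alpha}J+K$; $H\xrightarrow{\alpha}J$ gives $H|\xrightarrow{\alpha}J|$ and $|H\xrightarrow{\alpha}|J$; $H\xrightarrow{a}J$, $K\xrightarrow{\bar a}L$ gives $H|+|K\xrightarrow{\tau}J|+|L$; $H\xrightarrow{\alpha}J$, $a\ne\alpha\ne\bar a$ gives $H\backslash a\xrightarrow{\alpha}J\backslash a$; $H\xrightarrow{\alpha}J$ gives $H[f]\xrightarrow{f(\alpha)}J[f]$;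 $(dec(P)-K)\xrightarrow{\alpha}J$, $A\stackrel{def}{=}P$, $K\le dec(P)$ gives $\{A\}\xrightarrow{\alpha}J+K$. A transition $u$ is enabled at marking $M$ if its preset is $\le M$, and firing gives $M[u\rangle M'$ with $M'=M-{}^\bullet u+u^\bullet$. A path from marking $M_0$ is an alternating sequence $M_0u_1M_1u_2\dots$, infinite or ending in a marking, with $M_{k}[u_{k+1}\rangle M_{k+1}$. -}

module Defs where

open import Level using (Level)
open import Data.Nat using (ℕ; zero; suc; _<_; _≤_)
open import Data.Unit using (⊤)
open import Data.Product using (Σ; _×_; _,_)
open import Data.List using (List; []; _∷_; [_]; _++_; map)
open import Relation.Binary.PropositionalEquality using (_≡_; _≢_)
open import Data.List.Relation.Binary.Permutation.Propositional using (_↭_)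

data Len : Set where
  fin : ℕ → Len
  inf : Len

-- i <ᴸ l : there is an i-th (0-based) transition on a path of length l
_<ᴸ_ : ℕ → Len → Set
i <ᴸ fin n = i < n
i <ᴸ inf   = ⊤

-- i ≤ᴸ l : there is an i-th (0-based) state on a path of length l
_≤ᴸ_ : ℕ → Len → Set
i ≤ᴸ fin n = i ≤ n
i ≤ᴸ inf   = ⊤

-- CCS^! over names 𝒜, agent identifiers 𝒦 and output actions O.
module CCS (𝒜 𝒦 O : Set) where

  data Hand : Set where
    nm : 𝒜 → Hand
    co : 𝒜 → Hand

  bar : Hand → Hand
  bar (nm a) = co a
  bar (co a) = nm a

  data Act : Set where
    hs  : Hand → Act
    out : O → Act
    τ   : Act

  record Relabelling : Set where
    field
      fn    : Hand → Hand
      fn-co : ∀ h → fn (bar h) ≡ bar (fn h)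
  open Relabelling public

  relAct : Relabelling → Act → Act
  relAct f (hs h)  = hs (fn f h)
  relAct f (out o) = out o
  relAct f τ       = τ

  data Proc : Set₁ where
    ident : 𝒦 → Proc
    _∙_   : Act → Proc → Proc
    Sum   : (I : Set) → (I → Proc) → Proc
    _∣_   : Proc → Proc → Proc
    _∖_   : Proc → 𝒜 → Proc
    _⟦_⟧  : Proc → Relabelling → Proc

  -- places of the unmarked Petri net (grapes)
  data Grape : Set₁ where
    gId  : 𝒦 → Grape
    gPre : Act → Proc → Grape
    gSum : (I : Set) → (I → Proc) → Grape
    _∖g_ : Grape → 𝒜 → Grape
    _∣g  : Grape → Grape
    g∣_  : Grape → Grape
    _[_]g : Grape → Relabelling → Grape

  -- finite multisets of grapes are represented by lists, compared up to
  -- permutation (_↭_)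
  Marking : Set₁
  Marking = List Grape

  dec : Proc → Marking
  dec (ident A) = [ gId A ]
  dec (α ∙ P)   = [ gPre α P ]
  dec (Sum I Ps) = [ gSum I Ps ]
  dec (P ∣ Q)   = map _∣g (dec P) ++ map g∣_ (dec Q)
  dec (P ∖ a)   = map (_∖g a) (dec P)
  dec (P ⟦ f ⟧) = map (_[ f ]g) (dec P)

  -- Semantics, relative to the defining equations A ≝ def A
  module Semantics (def : 𝒦 → Proc) where

    infix 4 _—[_]→_
    data _—[_]→_ : Proc → Act → Proc → Set₁ where
      act  : ∀ {α P} → (α ∙ P) —[ α ]→ P
      sum  : ∀ {I Ps α P'} (j : I) → Ps j —[ α ]→ P' → Sum I Ps —[ α ]→ P'
      parL : ∀ {P Q α P'} → P —[ α ]→ P' → (P ∣ Q) —[ α ]→ (P' ∣ Q)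
      parR : ∀ {P Q α Q'} → Q —[ α ]→ Q' → (P ∣ Q) —[ α ]→ (P ∣ Q')
      comm : ∀ {P Q P' Q'} (h : Hand) → P —[ hs h ]→ P' → Q —[ hs (bar h) ]→ Q'
             → (P ∣ Q) —[ τ ]→ (P' ∣ Q')
      res  : ∀ {P α P' a} → α ≢ hs (nm a) → α ≢ hs (co a) → P —[ α ]→ P'
             → (P ∖ a) —[ α ]→ (P' ∖ a)
      rel  : ∀ {P α P' f} → P —[ α ]→ P' → (P ⟦ f ⟧) —[ relAct f α ]→ (P' ⟦ f ⟧)
      rec  : ∀ {A α P'} → def A —[ α ]→ P' → ident A —[ α ]→ P'

    infix 4 _—[_]⇒_
    data _—[_]⇒_ : Marking → Act → Marking → Set₁ where
      act  : ∀ {α P} → [ gPre α P ] —[ α ]⇒ dec P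
      sum  : ∀ {I Ps α H J K} (j : I) → H —[ α ]⇒ J → dec (Ps j) ↭ H ++ K
             → [ gSum I Ps ] —[ α ]⇒ J ++ K
      parL : ∀ {H α J} → H —[ α ]⇒ J → map _∣g H —[ α ]⇒ map _∣g J
      parR : ∀ {H α J} → H —[ α ]⇒ J → map g∣_ H —[ α ]⇒ map g∣_ J
      comm : ∀ {H J K L} (h : Hand) → H —[ hs h ]⇒ J → K —[ hs (bar h) ]⇒ L
             → map _∣g H ++ map g∣_ K —[ τ ]⇒ map _∣g J ++ map g∣_ L
      res  : ∀ {H α J a} → α ≢ hs (nm a) → α ≢ hs (co a) → H —[ α ]⇒ J
             → map (_∖g a) H —[ α ]⇒ map (_∖g a) J
      rel  : ∀ {H α J f} → H —[ α ]⇒ J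
             → map (_[ f ]g) H —[ relAct f α ]⇒ map (_[ f ]g) J
      rec  : ∀ {A α H J K} → H —[ α ]⇒ J → dec (def A) ↭ H ++ K
             → [ gId A ] —[ α ]⇒ J ++ K

    record NetTrans : Set₁ where
      field
        pre   : Marking
        ℓ     : Act
        post  : Marking
        deriv : pre —[ ℓ ]⇒ post
    open NetTrans public

    -- firing: M [u⟩ M'  iff  •u ≤ M and M' = M - •u + u•
    _[_⟩_ : Marking → NetTrans → Marking → Set₁
    M [ u ⟩ M' = Σ Marking λ R → (M ↭ pre u ++ R) × (M' ↭ R ++ post u)

    -- path M₀ u₁ M₁ u₂ M₂ … in the net (0-based: mark i = Mᵢ, trans i = uᵢ₊₁)
    record NetPath (M₀ : Marking) : Set₁ where
      field
        len   : Len
        mark  : ℕ → Marking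
        trans : ℕ → NetTrans
        start : mark 0 ↭ M₀
        steps : ∀ i → i <ᴸ len → mark i [ trans i ⟩ mark (suc i)
    open NetPath public

    -- path P₀ —α₁→ P₁ —α₂→ … in the LTS (state i = Pᵢ, label i = αᵢ₊₁)
    record LTSPath (P : Proc) : Set₁ where
      field
        lenL  : Len
        state : ℕ → Proc
        label : ℕ → Act
        startL : state 0 ≡ P
        stepsL : ∀ i → i <ᴸ lenL → state i —[ label i ]→ state (suc i)
    open LTSPath public

    Corresponds : ∀ {P} → NetPath (dec P) → LTSPath P → Set₁
    Corresponds π π̂ =
      (lenL π̂ ≡ len π)
      × (∀ i → i ≤ᴸ len π → dec (state π̂ i) ↭ mark π i)
      × (∀ i → i <ᴸ len π → ℓ (trans π i) ≡ label π̂ i)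

    SamePath : ∀ {P} → LTSPath P → LTSPath P → Set₁
    SamePath π₁ π₂ =
      (lenL π₁ ≡ lenL π₂)
      × (∀ i → i ≤ᴸ lenL π₁ → state π₁ i ≡ state π₂ i)
      × (∀ i → i <ᴸ lenL π₁ → label π₁ i ≡ label π₂ i)

module Submission where

-- A state P of the LTS is represented in the net by the marking dec P.  The
-- heart of the proof is a one-step simulation: if a net transition H —α⇒ J
-- fires at a marking dec P ↭ H ++ R, then P —α→ P' with dec P' ↭ J ++ R.
-- It is proved by induction on the derivation of the net transition, using
--   * shapes: every grape of dec P reveals the outermost operator of P, so
--     the preset of a transition determines the form of P, and
--   * embeddings: dec of a restriction, relabelling or parallel composition
--     is the image of the components' decompositions under an injective
--     map with a partial inverse; a frame R around the image of a preset is
--     itself such an image, and the components can be read off.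
-- The same two ingredients show that dec is injective up to permutation.
-- Iterating the simulation along a net path gives the LTS path π̂, and
-- injectivity of dec makes it unique.

open import Defs
open import Function using (_∘_)
open import Data.Empty using (⊥-elim)
open import Data.Maybe using (Maybe; just; nothing)
open import Data.Nat using (ℕ; zero; suc; _<?_)
open import Data.Nat.Properties using (<⇒≤)
open import Data.Product using (Σ; _×_; _,_; proj₁; proj₂)
open import Data.Sum using (_⊎_; inj₁; inj₂; isInj₁; isInj₂)
open import Data.Unit using (tt)
open import Data.List using (List; []; _∷_; [_]; _++_; map; mapMaybe)
open import Data.List.Properties
  using (map-++; map-∘; ∷-injectiveʳ; mapMaybe-++; mapMaybe-map-retract;
         mapMaybeIsInj₁∘mapInj₁; mapMaybeIsInj₁∘mapInj₂;
         mapMaybeIsInj₂∘mapInj₁; mapMaybeIsInj₂∘mapInj₂)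
  renaming (++-assoc to ++-assoc-≡; ++-identityʳ to ++-identityʳ-≡)
open import Data.List.Membership.Propositional using (_∈_)
open import Data.List.Membership.Propositional.Properties
  using (∈-map⁺; ∈-map⁻; ∈-++⁺ˡ; ∈-++⁻)
open import Data.List.Relation.Unary.Any using (here; there)
open import Data.List.Relation.Binary.Permutation.Propositional
  using (_↭_; ↭-refl; ↭-prep; ↭-sym; ↭-trans; ↭-reflexive; module PermutationReasoning)
open import Data.List.Relation.Binary.Permutation.Propositional.Properties
  using (map⁺; ↭-map-inv; ++⁺; ++⁺ˡ; ++-comm; shift; shifts; drop-∷;
         ↭-empty-inv; ∈-resp-↭; mapMaybe-↭)
open import Relation.Binary.PropositionalEquality
  using (_≡_; refl; sym; cong; cong₂; subst; subst₂; module ≡-Reasoning)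
open import Relation.Nullary using (Dec; yes; no)

_<ᴸ?_ : ∀ i l → Dec (i <ᴸ l)
i <ᴸ? fin n = i <? n
i <ᴸ? inf   = yes tt

<ᴸ⇒≤ᴸ : ∀ {i} l → i <ᴸ l → i ≤ᴸ l
<ᴸ⇒≤ᴸ (fin n) i<n = <⇒≤ i<n
<ᴸ⇒≤ᴸ inf     _   = tt

s≤ᴸ⇒<ᴸ : ∀ {i} l → suc i ≤ᴸ l → i <ᴸ l
s≤ᴸ⇒<ᴸ (fin n) i<n = i<n
s≤ᴸ⇒<ᴸ inf     _   = tt

module _ {a} {A : Set a} where

  occupant : ∀ {D} H {R} {x : A} → D ↭ H ++ R → x ∈ H → x ∈ D
  occupant H q m = ∈-resp-↭ (↭-sym q) (∈-++⁺ˡ m)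

  lone : ∀ {x : A} {R} → [ x ] ↭ x ∷ R → R ≡ []
  lone q = ↭-empty-inv (↭-sym (drop-∷ q))

  pad : ∀ {xs ys : List A} → xs ↭ ys → xs ↭ ys ++ []
  pad q = ↭-trans q (↭-reflexive (sym (++-identityʳ-≡ _)))

merge : ∀ {a b c} {A : Set a} {B : Set b} {C : Set c} →
        (A → C) → (B → C) → List A → List B → List C
merge f g A B = map f A ++ map g B

module _ {a b c} {A : Set a} {B : Set b} {C : Set c} (f : A → C) (g : B → C) where

  merge-++ : ∀ A₁ B₁ A₂ B₂ →
    merge f g A₁ B₁ ++ merge f g A₂ B₂ ↭ merge f g (A₁ ++ A₂) (B₁ ++ B₂)
  merge-++ A₁ B₁ A₂ B₂ = begin
    (map f A₁ ++ map g B₁) ++ (map f A₂ ++ map g B₂)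
      ≡⟨ ++-assoc-≡ (map f A₁) _ _ ⟩
    map f A₁ ++ (map g B₁ ++ (map f A₂ ++ map g B₂))
      ↭⟨ ++⁺ˡ (map f A₁) (shifts (map g B₁) (map f A₂)) ⟩
    map f A₁ ++ (map f A₂ ++ (map g B₁ ++ map g B₂))
      ≡⟨ sym (++-assoc-≡ (map f A₁) _ _) ⟩
    (map f A₁ ++ map f A₂) ++ (map g B₁ ++ map g B₂)
      ≡⟨ sym (cong₂ _++_ (map-++ f A₁ A₂) (map-++ g B₁ B₂)) ⟩
    merge f g (A₁ ++ A₂) (B₁ ++ B₂) ∎
    where open PermutationReasoning

  map-merge : ∀ {d} {D : Set d} (h : C → D) A B →
    map h (merge f g A B) ≡ merge (h ∘ f) (h ∘ g) A B
  map-merge h A B =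
    subst₂ (λ X Y → map h (merge f g A B) ≡ X ++ Y) (sym (map-∘ A)) (sym (map-∘ B))
      (map-++ h (map f A) (map g B))

module _ {a b} {A : Set a} {B : Set b} where

  tagged : List A → List B → List (A ⊎ B)
  tagged = merge inj₁ inj₂

  left-tagged : ∀ As Bs → mapMaybe isInj₁ (tagged As Bs) ≡ As
  left-tagged As Bs = begin
    mapMaybe isInj₁ (map inj₁ As ++ map inj₂ Bs)
      ≡⟨ mapMaybe-++ isInj₁ (map inj₁ As) (map inj₂ Bs) ⟩
    mapMaybe isInj₁ (map inj₁ As) ++ mapMaybe isInj₁ (map inj₂ Bs)
      ≡⟨ cong₂ _++_ (mapMaybeIsInj₁∘mapInj₁ As) (mapMaybeIsInj₁∘mapInj₂ Bs) ⟩
    As ++ []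
      ≡⟨ ++-identityʳ-≡ As ⟩
    As ∎
    where open ≡-Reasoning

  right-tagged : ∀ As Bs → mapMaybe isInj₂ (tagged As Bs) ≡ Bs
  right-tagged As Bs = begin
    mapMaybe isInj₂ (map inj₁ As ++ map inj₂ Bs)
      ≡⟨ mapMaybe-++ isInj₂ (map inj₁ As) (map inj₂ Bs) ⟩
    mapMaybe isInj₂ (map inj₁ As) ++ mapMaybe isInj₂ (map inj₂ Bs)
      ≡⟨ cong₂ _++_ (mapMaybeIsInj₂∘mapInj₁ As) (mapMaybeIsInj₂∘mapInj₂ Bs) ⟩
    Bs ∎
    where open ≡-Reasoning

  partition-↭ : ∀ xs → xs ↭ tagged (mapMaybe isInj₁ xs) (mapMaybe isInj₂ xs)
  partition-↭ []            = ↭-refl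
  partition-↭ (inj₁ x ∷ xs) = ↭-prep (inj₁ x) (partition-↭ xs)
  partition-↭ (inj₂ y ∷ xs) =
    ↭-trans (↭-prep (inj₂ y) (partition-↭ xs)) (↭-sym (shift (inj₂ y) _ _))

  tagged-reflect : ∀ {A₁ B₁ A₂ B₂} → tagged A₁ B₁ ↭ tagged A₂ B₂ → (A₁ ↭ A₂) × (B₁ ↭ B₂)
  tagged-reflect {A₁} {B₁} {A₂} {B₂} q =
      subst₂ _↭_ (left-tagged A₁ B₁) (left-tagged A₂ B₂) (mapMaybe-↭ isInj₁ q)
    , subst₂ _↭_ (right-tagged A₁ B₁) (right-tagged A₂ B₂) (mapMaybe-↭ isInj₂ q)

  tagged-split : ∀ {D₁ D₂ H₁ H₂} R → tagged D₁ D₂ ↭ tagged H₁ H₂ ++ R →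
    (D₁ ↭ H₁ ++ mapMaybe isInj₁ R) × (D₂ ↭ H₂ ++ mapMaybe isInj₂ R)
  tagged-split {H₁ = H₁} {H₂} R q = tagged-reflect
    (↭-trans q (↭-trans (++⁺ˡ (tagged H₁ H₂) (partition-↭ R))
                        (merge-++ inj₁ inj₂ H₁ H₂ _ _)))

module Embedding {a b} {A : Set a} {B : Set b}
                 (f : A → B) (p : B → Maybe A) (retract : ∀ x → p (f x) ≡ just x) where

  map-↭-reflect : ∀ {xs ys} → map f xs ↭ map f ys → xs ↭ ys
  map-↭-reflect {xs} {ys} q =
    subst₂ _↭_ (mapMaybe-map-retract retract xs) (mapMaybe-map-retract retract ys)
      (mapMaybe-↭ p q)

  image-suffix : ∀ H {R} ys → map f H ++ R ≡ map f ys → Σ (List A) λ R' → R ≡ map f R'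
  image-suffix []      ys       e = ys , e
  image-suffix (_ ∷ H) (_ ∷ ys) e = image-suffix H ys (∷-injectiveʳ e)

  unwrap : ∀ {D H R} → map f D ↭ map f H ++ R →
    Σ (List A) λ R' → R ≡ map f R' × D ↭ H ++ R'
  unwrap {D} {H} {R} q with ↭-map-inv f q
  ... | ys , e , _ with image-suffix H ys e
  ... | R' , refl = R' , refl , map-↭-reflect (↭-trans q (↭-reflexive (sym (map-++ f H R'))))

  map-frame : ∀ {D} J R → D ↭ J ++ R → map f D ↭ map f J ++ map f R
  map-frame J R q = ↭-trans (map⁺ f q) (↭-reflexive (map-++ f J R))

module Correspondence (𝒜 𝒦 O : Set) (def : 𝒦 → CCS.Proc 𝒜 𝒦 O) where
  open CCS 𝒜 𝒦 O
  open Semantics def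

  -- The outermost operator of a process, and of a grape.  Identifiers,
  -- prefixes and sums are their own (single) grape.
  data Shape : Set₁ where
    atom : Proc → Shape
    par  : Shape
    res  : 𝒜 → Shape
    rel  : Relabelling → Shape

  shape : Proc → Shape
  shape (P ∣ Q)   = par
  shape (P ∖ a)   = res a
  shape (P ⟦ f ⟧) = rel f
  shape P         = atom P

  shapeᵍ : Grape → Shape
  shapeᵍ (gId A)      = atom (ident A)
  shapeᵍ (gPre α P)   = atom (α ∙ P)
  shapeᵍ (gSum I Ps)  = atom (Sum I Ps)
  shapeᵍ (x ∖g a)     = res a
  shapeᵍ (x ∣g)       = par
  shapeᵍ (g∣ x)       = par
  shapeᵍ (x [ f ]g)   = rel f

  shape-dec : ∀ P {x} → x ∈ dec P → shapeᵍ x ≡ shape P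
  shape-dec (ident A)  (here refl) = refl
  shape-dec (ident A)  (there ())
  shape-dec (α ∙ P)    (here refl) = refl
  shape-dec (α ∙ P)    (there ())
  shape-dec (Sum I Ps) (here refl) = refl
  shape-dec (Sum I Ps) (there ())
  shape-dec (P ∣ Q) m with ∈-++⁻ (map _∣g (dec P)) m
  ... | inj₁ m₁ with ∈-map⁻ _∣g m₁
  ...   | _ , _ , refl = refl
  shape-dec (P ∣ Q) m | inj₂ m₂ with ∈-map⁻ g∣_ m₂
  ...   | _ , _ , refl = refl
  shape-dec (P ∖ a) m with ∈-map⁻ (_∖g a) m
  ... | _ , _ , refl = refl
  shape-dec (P ⟦ f ⟧) m with ∈-map⁻ (_[ f ]g) m
  ... | _ , _ , refl = refl

  data View : Shape → Proc → Set₁ where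
    atomic     : ∀ {P} → View (atom P) P
    parallel   : ∀ {P Q} → View par (P ∣ Q)
    restricted : ∀ {P a} → View (res a) (P ∖ a)
    relabelled : ∀ {P f} → View (rel f) (P ⟦ f ⟧)

  view : ∀ P → View (shape P) P
  view (ident A)  = atomic
  view (α ∙ P)    = atomic
  view (Sum I Ps) = atomic
  view (P ∣ Q)    = parallel
  view (P ∖ a)    = restricted
  view (P ⟦ f ⟧)  = relabelled

  shaped : ∀ P {x} → x ∈ dec P → View (shapeᵍ x) P
  shaped P m = subst (λ s → View s P) (sym (shape-dec P m)) (view P)

  dec-occupied : ∀ P → Σ Grape (_∈ dec P)
  dec-occupied (ident A)  = _ , here refl
  dec-occupied (α ∙ P)    = _ , here refl
  dec-occupied (Sum I Ps) = _ , here refl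
  dec-occupied (P ∣ Q)    = _ , ∈-++⁺ˡ (∈-map⁺ _∣g (proj₂ (dec-occupied P)))
  dec-occupied (P ∖ a)    = _ , ∈-map⁺ (_∖g a) (proj₂ (dec-occupied P))
  dec-occupied (P ⟦ f ⟧)  = _ , ∈-map⁺ (_[ f ]g) (proj₂ (dec-occupied P))

  occupied : ∀ {H α J} → H —[ α ]⇒ J → Σ Grape (_∈ H)
  occupied act            = _ , here refl
  occupied (sum j d e)    = _ , here refl
  occupied (rec d e)      = _ , here refl
  occupied (parL d)       = _ , ∈-map⁺ _∣g (proj₂ (occupied d))
  occupied (parR d)       = _ , ∈-map⁺ g∣_ (proj₂ (occupied d))
  occupied (comm h d₁ d₂) = _ , ∈-++⁺ˡ (∈-map⁺ _∣g (proj₂ (occupied d₁)))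
  occupied (res _ _ d)    = _ , ∈-map⁺ _ (proj₂ (occupied d))
  occupied (rel d)        = _ , ∈-map⁺ _ (proj₂ (occupied d))

  unres : Grape → Maybe Grape
  unres (x ∖g _) = just x
  unres _        = nothing

  unrel : Grape → Maybe Grape
  unrel (x [ _ ]g) = just x
  unrel _          = nothing

  side : Grape ⊎ Grape → Grape
  side (inj₁ x) = x ∣g
  side (inj₂ x) = g∣ x

  unside : Grape → Maybe (Grape ⊎ Grape)
  unside (x ∣g) = just (inj₁ x)
  unside (g∣ x) = just (inj₂ x)
  unside _      = nothing

  unside-side : ∀ y → unside (side y) ≡ just y
  unside-side (inj₁ x) = refl
  unside-side (inj₂ x) = refl

  module UnderRes (a : 𝒜)          = Embedding (_∖g a) unres (λ _ → refl)
  module UnderRel (f : Relabelling) = Embedding (_[ f ]g) unrel (λ _ → refl)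
  module UnderPar                   = Embedding side unside unside-side

  parM : Marking → Marking → Marking
  parM = merge _∣g g∣_

  parM-side : ∀ A B → parM A B ≡ map side (tagged A B)
  parM-side A B = sym (map-merge inj₁ inj₂ side A B)

  parM-left : ∀ H → parM H [] ≡ map _∣g H
  parM-left H = ++-identityʳ-≡ (map _∣g H)

  par-reflect : ∀ {A₁ B₁ A₂ B₂} → parM A₁ B₁ ↭ parM A₂ B₂ → (A₁ ↭ A₂) × (B₁ ↭ B₂)
  par-reflect {A₁} {B₁} {A₂} {B₂} q =
    tagged-reflect (UnderPar.map-↭-reflect (subst₂ _↭_ (parM-side A₁ B₁) (parM-side A₂ B₂) q))

  split-par : ∀ {D₁ D₂} H₁ H₂ {R} → parM D₁ D₂ ↭ parM H₁ H₂ ++ R →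
    Σ Marking λ R₁ → Σ Marking λ R₂ →
      (R ↭ parM R₁ R₂) × (D₁ ↭ H₁ ++ R₁) × (D₂ ↭ H₂ ++ R₂)
  split-par {D₁} {D₂} H₁ H₂ {R} q
    with UnderPar.unwrap {tagged D₁ D₂} {tagged H₁ H₂} {R} (subst₂ (λ X Y → X ↭ Y ++ R) (parM-side D₁ D₂) (parM-side H₁ H₂) q)
  ... | R' , refl , q' =
      mapMaybe isInj₁ R' , mapMaybe isInj₂ R'
    , ↭-trans (map⁺ side (partition-↭ R')) (↭-reflexive (sym (parM-side (mapMaybe isInj₁ R') (mapMaybe isInj₂ R'))))
    , tagged-split R' q'

  join-par : ∀ {D₁ D₂} J₁ J₂ R₁ R₂ {R} → R ↭ parM R₁ R₂ →
    D₁ ↭ J₁ ++ R₁ → D₂ ↭ J₂ ++ R₂ → parM D₁ D₂ ↭ parM J₁ J₂ ++ R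
  join-par {D₁} {D₂} J₁ J₂ R₁ R₂ {R} r q₁ q₂ = begin
    parM D₁ D₂                 ↭⟨ ++⁺ (map⁺ _∣g q₁) (map⁺ g∣_ q₂) ⟩
    parM (J₁ ++ R₁) (J₂ ++ R₂) ↭⟨ ↭-sym (merge-++ _∣g g∣_ J₁ J₂ R₁ R₂) ⟩
    parM J₁ J₂ ++ parM R₁ R₂   ↭⟨ ++⁺ˡ (parM J₁ J₂) (↭-sym r) ⟩
    parM J₁ J₂ ++ R            ∎
    where open PermutationReasoning

  dec-injective : ∀ P Q → dec P ↭ dec Q → P ≡ Q
  dec-injective (ident A) Q q with shaped Q (∈-resp-↭ q (here refl))
  ... | atomic = refl
  dec-injective (α ∙ P) Q q with shaped Q (∈-resp-↭ q (here refl))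
  ... | atomic = refl
  dec-injective (Sum I Ps) Q q with shaped Q (∈-resp-↭ q (here refl))
  ... | atomic = refl
  dec-injective (P₁ ∣ P₂) Q q
    with shaped Q (∈-resp-↭ q (∈-++⁺ˡ (∈-map⁺ _∣g (proj₂ (dec-occupied P₁)))))
  ... | parallel {Q₁} {Q₂} with par-reflect q
  ...   | q₁ , q₂ = cong₂ _∣_ (dec-injective P₁ Q₁ q₁) (dec-injective P₂ Q₂ q₂)
  dec-injective (P ∖ a) Q q
    with shaped Q (∈-resp-↭ q (∈-map⁺ (_∖g a) (proj₂ (dec-occupied P))))
  ... | restricted = cong (_∖ a) (dec-injective P _ (UnderRes.map-↭-reflect a q))
  dec-injective (P ⟦ f ⟧) Q q
    with shaped Q (∈-resp-↭ q (∈-map⁺ (_[ f ]g) (proj₂ (dec-occupied P))))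
  ... | relabelled = cong (_⟦ f ⟧) (dec-injective P _ (UnderRel.map-↭-reflect f q))

  Answer : Proc → Act → Marking → Marking → Set₁
  Answer P α J R = Σ Proc λ P' → (P —[ α ]→ P') × (dec P' ↭ J ++ R)

  simulate : ∀ {H α J} → H —[ α ]⇒ J → ∀ P R → dec P ↭ H ++ R → Answer P α J R
  simulate (act {P = Q}) P R q with shaped P (occupant [ _ ] q (here refl))
  ... | atomic with lone q
  ...   | refl = Q , act , pad ↭-refl
  simulate (sum j d e) P R q with shaped P (occupant [ _ ] q (here refl))
  ... | atomic with lone q
  ...   | refl with simulate d _ _ e
  ...     | P' , t , q' = P' , sum j t , pad q'
  simulate (rec d e) P R q with shaped P (occupant [ _ ] q (here refl))
  ... | atomic with lone q
  ...   | refl with simulate d _ _ e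
  ...     | P' , t , q' = P' , rec t , pad q'
  simulate (parL {H} {J = J} d) P R q
    with shaped P (occupant (map _∣g H) q (∈-map⁺ _∣g (proj₂ (occupied d))))
  ... | parallel with split-par H [] (subst (λ X → _ ↭ X ++ R) (sym (parM-left H)) q)
  ...   | R₁ , R₂ , r , q₁ , q₂ with simulate d _ R₁ q₁
  ...     | P₁' , t , q₁' = P₁' ∣ _ , parL t ,
    subst (λ X → _ ↭ X ++ R) (parM-left J) (join-par J [] R₁ R₂ r q₁' q₂)
  simulate (parR {H} {J = J} d) P R q
    with shaped P (occupant (map g∣_ H) q (∈-map⁺ g∣_ (proj₂ (occupied d))))
  ... | parallel with split-par [] H q
  ...   | R₁ , R₂ , r , q₁ , q₂ with simulate d _ R₂ q₂
  ...     | P₂' , t , q₂' = _ ∣ P₂' , parR t , join-par [] J R₁ R₂ r q₁ q₂'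
  simulate (comm {H₁} {J₁} {H₂} {J₂} h d₁ d₂) P R q
    with shaped P (occupant (parM H₁ H₂) q (∈-++⁺ˡ (∈-map⁺ _∣g (proj₂ (occupied d₁)))))
  ... | parallel with split-par H₁ H₂ q
  ...   | R₁ , R₂ , r , q₁ , q₂ with simulate d₁ _ R₁ q₁ | simulate d₂ _ R₂ q₂
  ...     | P₁' , t₁ , q₁' | P₂' , t₂ , q₂' =
    P₁' ∣ P₂' , comm h t₁ t₂ , join-par J₁ J₂ R₁ R₂ r q₁' q₂'
  simulate (res {H} {J = J} {a} n₁ n₂ d) P R q
    with shaped P (occupant (map (_∖g a) H) q (∈-map⁺ (_∖g a) (proj₂ (occupied d))))
  ... | restricted with UnderRes.unwrap a {R = R} q
  ...   | R' , refl , q₁ with simulate d _ R' q₁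
  ...     | P' , t , q' = P' ∖ a , res n₁ n₂ t , UnderRes.map-frame a J R' q'
  simulate (rel {H} {J = J} {f} d) P R q
    with shaped P (occupant (map (_[ f ]g) H) q (∈-map⁺ (_[ f ]g) (proj₂ (occupied d))))
  ... | relabelled with UnderRel.unwrap f {R = R} q
  ...   | R' , refl , q₁ with simulate d _ R' q₁
  ...     | P' , t , q' = P' ⟦ f ⟧ , rel t , UnderRel.map-frame f J R' q'

  fire : ∀ Q {M} u {M'} → M [ u ⟩ M' → dec Q ↭ M →
    Σ Proc λ Q' → (Q —[ ℓ u ]→ Q') × (dec Q' ↭ M')
  fire Q u (R , M↭ , M'↭) q with simulate (deriv u) Q R (↭-trans q M↭)
  ... | Q' , t , q' = Q' , t , ↭-trans q' (↭-trans (++-comm (post u) R) (↭-sym M'↭))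

  module Reconstruction (P : Proc) (π : NetPath (dec P)) where

    Matches : ℕ → Proc → Set₁
    Matches i Q = i ≤ᴸ len π → dec Q ↭ mark π i

    Advance : ℕ → Proc → Set₁
    Advance i Q = Σ Proc λ Q' → Matches (suc i) Q' × (i <ᴸ len π → Q —[ ℓ (trans π i) ]→ Q')

    advance : ∀ i {Q} → Matches i Q → Dec (i <ᴸ len π) → Advance i Q
    advance i {Q} m (yes i<) with fire Q (trans π i) (steps π i i<) (m (<ᴸ⇒≤ᴸ (len π) i<))
    ... | Q' , t , q' = Q' , (λ _ → q') , (λ _ → t)
    advance i {Q} m (no i≮) =
      Q , (λ i<′ → ⊥-elim (i≮ (s≤ᴸ⇒<ᴸ (len π) i<′))) , (λ i< → ⊥-elim (i≮ i<))

    trace : ∀ i → Σ Proc (Matches i)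
    successor : ∀ i → Advance i (proj₁ (trace i))

    trace zero    = P , λ _ → ↭-sym (start π)
    trace (suc i) = proj₁ (successor i) , proj₁ (proj₂ (successor i))

    successor i = advance i (proj₂ (trace i)) (i <ᴸ? len π)

    π̂ : LTSPath P
    π̂ = record
      { lenL   = len π
      ; state  = proj₁ ∘ trace
      ; label  = ℓ ∘ trans π
      ; startL = refl
      ; stepsL = λ i → proj₂ (proj₂ (successor i))
      }

    corresponds : Corresponds π π̂
    corresponds = refl , (λ i → proj₂ (trace i)) , (λ i _ → refl)

    unique : ∀ π̂′ → Corresponds π π̂′ → SamePath π̂ π̂′
    unique π̂′ (len≡ , decs , labels) =
        sym len≡
      , (λ i i≤ → dec-injective _ _ (↭-trans (proj₂ (trace i) i≤) (↭-sym (decs i i≤))))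
      , labels

lemma10 : (𝒜 𝒦 O : Set) (def : 𝒦 → CCS.Proc 𝒜 𝒦 O) →
    let open CCS 𝒜 𝒦 O
        open Semantics def
    in ∀ (P : Proc) (π : NetPath (dec P)) →
         Σ (LTSPath P) λ π̂ →
           Corresponds π π̂ × (∀ (π̂′ : LTSPath P) → Corresponds π π̂′ → SamePath π̂ π̂′)
lemma10 𝒜 𝒦 O def P π = π̂ , corresponds , unique
  where open Correspondence.Reconstruction 𝒜 𝒦 O def P π
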